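{- In the formal power series ring $\mathbb{Q}[[x]]$, let $\beta=\frac{1-\sqrt{1-4x}}{2}=\sum_{k=0}^{\infty}\frac{1}{k+1}\binom{2k}{k}x^{k+1}$, so that $\beta(1-\beta)=x$. Then \[ \sum_{k=1}^{\infty}\binom{2k}{k}\left(\frac{H_k^{(2)}}{k}+\frac{1}{k^3}\right)x^k=4\,{\rm Li}_3(\beta)+\frac{2}{3}{\rm Li}_1(\beta)^3. \]
   Context: $H_k^{(2)}=\sum_{j=1}^{k}1/j^2$. For an integer $d$, ${\rm Li}_d(t)=\sum_{k=1}^{\infty}t^k/k^d$ is the polylogarithm viewed as a formal power series; ${\rm Li}_d(\beta)$ denotes its composition with $\beta\in x\mathbb{Q}[[x]]$. -}

module Defs where

open import Data.Nat as ℕ using (ℕ; zero; suc; _∸_; _^_)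
open import Data.Nat.Properties using (m^n≢0)
open import Data.Nat.Combinatorics using (_C_)
open import Data.Integer using (+_)
open import Data.Rational using (ℚ; _+_; _*_; _/_; 0ℚ; 1ℚ)

sumTo : ℕ → (ℕ → ℚ) → ℚ
sumTo zero    f = f 0
sumTo (suc n) f = sumTo n f + f (suc n)

PowerSeries : Set
PowerSeries = ℕ → ℚ

infixl 6 _⊕_
infixl 7 _·_ _⊛_

_⊕_ : PowerSeries → PowerSeries → PowerSeries
(f ⊕ g) n = f n + g n

_·_ : ℚ → PowerSeries → PowerSeries
(c · f) n = c * f n

_⊛_ : PowerSeries → PowerSeries → PowerSeries
(f ⊛ g) n = sumTo n (λ i → f i * g (n ∸ i))

oneS : PowerSeries
oneS zero    = 1ℚ
oneS (suc _) = 0ℚ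

powS : PowerSeries → ℕ → PowerSeries
powS g zero    = oneS
powS g (suc k) = g ⊛ powS g k

-- Composition f(g) for g with zero constant term:
-- [x^n] f(g) = Σ_{k=0}^{n} f_k [x^n] g^k  (terms with k > n vanish since g(0)=0)
compose : PowerSeries → PowerSeries → PowerSeries
compose f g n = sumTo n (λ k → f k * powS g k n)

Li : ℕ → PowerSeries
Li d zero    = 0ℚ
Li d (suc m) = ((+ 1) / (suc m ^ d)) {{m^n≢0 (suc m) d}}

β : PowerSeries
β zero    = 0ℚ
β (suc k) = (+ ((2 ℕ.* k) C k)) / suc k

H2 : ℕ → ℚ
H2 zero    = 0ℚ
H2 (suc k) = H2 k + (+ 1) / (suc k ℕ.* suc k)

lhsSeries : PowerSeries
lhsSeries zero    = 0ℚ
lhsSeries (suc m) =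
  (+ ((2 ℕ.* suc m) C suc m) / 1) *
    (H2 (suc m) * ((+ 1) / suc m) + (+ 1) / (suc m ℕ.* suc m ℕ.* suc m))

rhsSeries : PowerSeries
rhsSeries = ((+ 4) / 1) · compose (Li 3) β
          ⊕ ((+ 2) / 3) · powS (compose (Li 1) β) 3

-- All identities are proved with the Euler operator D = x d/dx:
-- two series agree when their constant terms and their images under D agree.  With B = Σ C(2k,k) xᵏ it then derives, from coefficient
-- recurrences, the algebraic relations  B² (1-4x) = 1,  B (1-2β) = 1,
-- β (1-β) = x  and  D Li_{d+1}(β) = Li_d(β) (1-β) B.  These give closed forms
-- for Σ C(2k,k)/k xᵏ, Σ C(2k,k)/k² xᵏ and Σ C(2k,k) H_k^{(2)} xᵏ in terms of
-- Li₁(β), Li₂(β), and the theorem follows by comparing images under D.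

module Submission where

open import Defs
open import Data.Nat as ℕ using (ℕ; zero; suc; _∸_; _≤_; _<_; z≤n; s≤s; NonZero)
import Data.Nat.Properties as ℕP

module CentralBinomial where

  open import Data.Nat
  open import Data.Nat.Properties
  open import Data.Nat.Combinatorics
  open import Data.Nat.Combinatorics.Specification using (k>n⇒nCk≡0)
  open import Data.Nat.Solver using (module +-*-Solver)
  open import Relation.Binary.PropositionalEquality
  open +-*-Solver

  absorption : ∀ n k → suc k * (suc n C suc k) ≡ suc n * (n C k)
  absorption zero    zero    = refl
  absorption zero    (suc k) = trans (cong (suc (suc k) *_) (k>n⇒nCk≡0 {1} {suc (suc k)} (s≤s (s≤s z≤n))))
                                 (trans (*-zeroʳ (suc (suc k))) (sym (cong (1 *_) (k>n⇒nCk≡0 {0} {suc k} (s≤s z≤n)))))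
  absorption (suc n) zero    = trans (*-identityˡ _) (trans (nC1≡n (suc (suc n))) (sym (*-identityʳ (suc (suc n)))))
  absorption (suc n) (suc k) = begin
    suc (suc k) * (suc (suc n) C suc (suc k))
      ≡⟨ cong (suc (suc k) *_) (sym (nCk+nC[k+1]≡[n+1]C[k+1] (suc n) (suc k))) ⟩
    suc (suc k) * (suc n C suc k + suc n C suc (suc k))
      ≡⟨ expand k (suc n C suc k) (suc n C suc (suc k)) ⟩
    suc k * (suc n C suc k) + suc n C suc k + suc (suc k) * (suc n C suc (suc k))
      ≡⟨ cong₂ (λ a b → a + suc n C suc k + b) (absorption n k) (absorption n (suc k)) ⟩
    suc n * (n C k) + suc n C suc k + suc n * (n C suc k)
      ≡⟨ collect (suc n) (n C k) (n C suc k) (suc n C suc k) ⟩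
    suc n * (n C k + n C suc k) + suc n C suc k
      ≡⟨ cong (λ t → suc n * t + suc n C suc k) (nCk+nC[k+1]≡[n+1]C[k+1] n k) ⟩
    suc n * (suc n C suc k) + suc n C suc k
      ≡⟨ +-comm (suc n * (suc n C suc k)) _ ⟩
    suc (suc n) * (suc n C suc k)
      ∎
    where
    open ≡-Reasoning
    expand : ∀ k a b → suc (suc k) * (a + b) ≡ suc k * a + a + suc (suc k) * b
    expand = solve 3 (λ k a b → (con 2 :+ k) :* (a :+ b) := (con 1 :+ k) :* a :+ a :+ (con 2 :+ k) :* b) refl
    collect : ∀ m a b c → m * a + c + m * b ≡ m * (a + b) + c
    collect = solve 4 (λ m a b c → m :* a :+ c :+ m :* b := m :* (a :+ b) :+ c) refl

  central-recurrence : ∀ n → suc n * ((2 * suc n) C suc n) ≡ (4 * n + 2) * ((2 * n) C n)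
  central-recurrence n = *-cancelˡ-≡ _ _ (suc n) (begin
    suc n * (suc n * ((2 * suc n) C suc n))
      ≡⟨ cong (λ t → suc n * (suc n * (t C suc n))) (double-suc n) ⟩
    suc n * (suc n * (suc (suc (2 * n)) C suc n))
      ≡⟨ cong (suc n *_) (absorption (suc (2 * n)) n) ⟩
    suc n * (suc (suc (2 * n)) * (suc (2 * n) C n))
      ≡⟨ cong (λ t → suc n * (suc (suc (2 * n)) * t)) symmetry ⟩
    suc n * (suc (suc (2 * n)) * (suc (2 * n) C suc n))
      ≡⟨ swap n (suc (2 * n) C suc n) ⟩
    suc (suc (2 * n)) * (suc n * (suc (2 * n) C suc n))
      ≡⟨ cong (suc (suc (2 * n)) *_) (absorption (2 * n) n) ⟩
    suc (suc (2 * n)) * (suc (2 * n) * ((2 * n) C n))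
      ≡⟨ regroup n ((2 * n) C n) ⟩
    suc n * ((4 * n + 2) * ((2 * n) C n))
      ∎)
    where
    open ≡-Reasoning
    double-suc : ∀ n → 2 * suc n ≡ suc (suc (2 * n))
    double-suc = solve 1 (λ n → con 2 :* (con 1 :+ n) := con 2 :+ con 2 :* n) refl
    swap : ∀ n a → suc n * (suc (suc (2 * n)) * a) ≡ suc (suc (2 * n)) * (suc n * a)
    swap = solve 2 (λ n a → (con 1 :+ n) :* ((con 2 :+ con 2 :* n) :* a)
                          := (con 2 :+ con 2 :* n) :* ((con 1 :+ n) :* a)) refl
    regroup : ∀ n a → suc (suc (2 * n)) * (suc (2 * n) * a) ≡ suc n * ((4 * n + 2) * a)
    regroup = solve 2 (λ n a → (con 2 :+ con 2 :* n) :* ((con 1 :+ con 2 :* n) :* a)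
                             := (con 1 :+ n) :* ((con 4 :* n :+ con 2) :* a)) refl
    symmetry : suc (2 * n) C n ≡ suc (2 * n) C suc n
    symmetry = trans (nCk≡nC[n∸k] {n} {suc (2 * n)} (≤-trans (m≤m+n n (n + 0)) (n≤1+n _)))
                     (cong (suc (2 * n) C_) complement)
      where
      complement : suc (2 * n) ∸ n ≡ suc n
      complement = trans (cong (λ t → suc t ∸ n) (+-comm n (n + 0)))
                     (trans (+-∸-assoc 1 {n + 0 + n} {n} (m≤n+m n (n + 0)))
                       (cong suc (trans (m+n∸n≡m (n + 0) n) (+-identityʳ n))))

-- The rational operators are opened only now, since they share their names
-- with the natural-number operators used above.
open import Data.Nat.Combinatorics using (_C_)
open import Data.Integer as ℤ using () renaming (+_ to pos)
import Data.Integer.Properties as ℤP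
open import Data.Rational as ℚ using (ℚ; _+_; _*_; _/_; 0ℚ; 1ℚ; -_; toℚᵘ)
import Data.Rational.Properties as ℚP
open import Data.Rational.Unnormalised as ℚᵘ using (mkℚᵘ; *≡*) renaming (_≃_ to _≃ᵘ_)
import Data.Rational.Unnormalised.Properties as ℚᵘP
open import Data.Sum using (inj₁; inj₂)
import Data.Rational.Solver as ℚSolver
open import Data.Product using (_,_)
open import Data.Maybe using (Maybe; just; nothing)
open import Relation.Nullary using (yes; no)
open import Relation.Binary.PropositionalEquality
open import Relation.Binary.Structures using (IsEquivalence)
open import Algebra.Structures using (IsCommutativeMonoid)
open import Algebra.Structures.Biased using (IsCommutativeSemiringˡ)
open import Algebra.Solver.Ring.AlmostCommutativeRing
  using (AlmostCommutativeRing; _-Raw-AlmostCommutative⟶_)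
import Algebra.Solver.Ring
open import Algebra.Properties.Group ℚP.+-0-group
  using () renaming (∙-cancelʳ to +-cancelʳ; x∙y⁻¹≈ε⇒x≈y to difference-zero)
import Relation.Binary.Reasoning.Setoid as SetoidReasoning

open CentralBinomial using (central-recurrence)

ι : ℕ → ℚ
ι n = pos n / 1

recip : (d : ℕ) → .{{NonZero d}} → ℚ
recip d = pos 1 / d

-- A normalised fraction i/(k+1) has the unnormalised representative i/(k+1);
-- all identities below are checked on these representatives.
toℚᵘ-/ : ∀ i k → toℚᵘ (i / suc k) ≃ᵘ mkℚᵘ i k
toℚᵘ-/ i k = ℚP.toℚᵘ-fromℚᵘ (mkℚᵘ i k)

ι-+ : ∀ m n → ι m + ι n ≡ ι (m ℕ.+ n)
ι-+ m n = ℚP.toℚᵘ-injective (begin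
  toℚᵘ (ι m + ι n)                   ≈⟨ ℚP.toℚᵘ-homo-+ (ι m) (ι n) ⟩
  toℚᵘ (ι m) ℚᵘ.+ toℚᵘ (ι n)         ≈⟨ ℚᵘP.+-cong (toℚᵘ-/ (pos m) 0) (toℚᵘ-/ (pos n) 0) ⟩
  mkℚᵘ (pos m) 0 ℚᵘ.+ mkℚᵘ (pos n) 0 ≈⟨ *≡* (cong (ℤ._* pos 1) integers) ⟩
  mkℚᵘ (pos (m ℕ.+ n)) 0             ≈⟨ ℚᵘP.≃-sym (toℚᵘ-/ (pos (m ℕ.+ n)) 0) ⟩
  toℚᵘ (ι (m ℕ.+ n))                 ∎)
  where
  open ℚᵘP.≃-Reasoning
  integers : pos m ℤ.* pos 1 ℤ.+ pos n ℤ.* pos 1 ≡ pos (m ℕ.+ n)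
  integers = trans (cong₂ ℤ._+_ (ℤP.*-identityʳ (pos m)) (ℤP.*-identityʳ (pos n))) (sym (ℤP.pos-+ m n))

ι-* : ∀ m n → ι m * ι n ≡ ι (m ℕ.* n)
ι-* m n = ℚP.toℚᵘ-injective (begin
  toℚᵘ (ι m * ι n)                   ≈⟨ ℚP.toℚᵘ-homo-* (ι m) (ι n) ⟩
  toℚᵘ (ι m) ℚᵘ.* toℚᵘ (ι n)         ≈⟨ ℚᵘP.*-cong (toℚᵘ-/ (pos m) 0) (toℚᵘ-/ (pos n) 0) ⟩
  mkℚᵘ (pos m) 0 ℚᵘ.* mkℚᵘ (pos n) 0 ≈⟨ *≡* (cong (ℤ._* pos 1) (sym (ℤP.pos-* m n))) ⟩
  mkℚᵘ (pos (m ℕ.* n)) 0             ≈⟨ ℚᵘP.≃-sym (toℚᵘ-/ (pos (m ℕ.* n)) 0) ⟩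
  toℚᵘ (ι (m ℕ.* n))                 ∎)
  where open ℚᵘP.≃-Reasoning

ι*recip : ∀ d .{{_ : NonZero d}} → ι d * recip d ≡ 1ℚ
ι*recip (suc k) = ℚP.toℚᵘ-injective (begin
  toℚᵘ (ι (suc k) * recip (suc k))           ≈⟨ ℚP.toℚᵘ-homo-* (ι (suc k)) (recip (suc k)) ⟩
  toℚᵘ (ι (suc k)) ℚᵘ.* toℚᵘ (recip (suc k)) ≈⟨ ℚᵘP.*-cong (toℚᵘ-/ (pos (suc k)) 0) (toℚᵘ-/ (pos 1) k) ⟩
  mkℚᵘ (pos (suc k)) 0 ℚᵘ.* mkℚᵘ (pos 1) k   ≈⟨ *≡* integers ⟩
  ℚᵘ.1ℚᵘ                                     ∎)
  where
  open ℚᵘP.≃-Reasoning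
  integers : (pos (suc k) ℤ.* pos 1) ℤ.* pos 1 ≡ pos 1 ℤ.* pos (1 ℕ.* suc k)
  integers = trans (ℤP.*-identityʳ _) (trans (ℤP.*-identityʳ _)
               (trans (cong pos (sym (ℕP.*-identityˡ (suc k)))) (sym (ℤP.*-identityˡ _))))

/≡ι*recip : ∀ c d .{{_ : NonZero d}} → pos c / d ≡ ι c * recip d
/≡ι*recip c (suc k) = ℚP.toℚᵘ-injective (begin
  toℚᵘ (pos c / suc k)                 ≈⟨ toℚᵘ-/ (pos c) k ⟩
  mkℚᵘ (pos c) k                       ≈⟨ *≡* integers ⟩
  mkℚᵘ (pos c) 0 ℚᵘ.* mkℚᵘ (pos 1) k   ≈⟨ ℚᵘP.≃-sym (ℚᵘP.*-cong (toℚᵘ-/ (pos c) 0) (toℚᵘ-/ (pos 1) k)) ⟩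
  toℚᵘ (ι c) ℚᵘ.* toℚᵘ (recip (suc k)) ≈⟨ ℚᵘP.≃-sym (ℚP.toℚᵘ-homo-* (ι c) (recip (suc k))) ⟩
  toℚᵘ (ι c * recip (suc k))           ∎)
  where
  open ℚᵘP.≃-Reasoning
  integers : pos c ℤ.* pos (1 ℕ.* suc k) ≡ (pos c ℤ.* pos 1) ℤ.* pos (suc k)
  integers = sym (cong₂ ℤ._*_ (ℤP.*-identityʳ (pos c)) (cong pos (sym (ℕP.*-identityˡ (suc k)))))

recip-* : ∀ a b .{{_ : NonZero a}} .{{_ : NonZero b}} →
          recip (a ℕ.* b) {{ℕP.m*n≢0 a b}} ≡ recip a * recip b
recip-* (suc a) (suc b) = ℚP.toℚᵘ-injective (begin
  toℚᵘ (recip (suc a ℕ.* suc b))                 ≈⟨ toℚᵘ-/ (pos 1) _ ⟩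
  mkℚᵘ (pos 1) a ℚᵘ.* mkℚᵘ (pos 1) b             ≈⟨ ℚᵘP.≃-sym (ℚᵘP.*-cong (toℚᵘ-/ (pos 1) a) (toℚᵘ-/ (pos 1) b)) ⟩
  toℚᵘ (recip (suc a)) ℚᵘ.* toℚᵘ (recip (suc b)) ≈⟨ ℚᵘP.≃-sym (ℚP.toℚᵘ-homo-* (recip (suc a)) (recip (suc b))) ⟩
  toℚᵘ (recip (suc a) * recip (suc b))           ∎)
  where open ℚᵘP.≃-Reasoning

ι-cancel : ∀ n {a b} → ι (suc n) * a ≡ ι (suc n) * b → a ≡ b
ι-cancel n {a} {b} eq = begin
  a                               ≡⟨ sym (unscale a) ⟩
  recip (suc n) * (ι (suc n) * a) ≡⟨ cong (recip (suc n) *_) eq ⟩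
  recip (suc n) * (ι (suc n) * b) ≡⟨ unscale b ⟩
  b                               ∎
  where
  open ≡-Reasoning
  unscale : ∀ c → recip (suc n) * (ι (suc n) * c) ≡ c
  unscale c = trans (sym (ℚP.*-assoc (recip (suc n)) (ι (suc n)) c))
                (trans (cong (_* c) (trans (ℚP.*-comm (recip (suc n)) (ι (suc n))) (ι*recip (suc n))))
                  (ℚP.*-identityˡ c))

cancel-recip : ∀ a k → ι (suc k) * (a * recip (suc k)) ≡ a
cancel-recip a k = trans (regroup (ι (suc k)) a (recip (suc k)))
                     (trans (cong (a *_) (ι*recip (suc k))) (ℚP.*-identityʳ a))
  where
  open ℚSolver.+-*-Solver
  regroup : ∀ s a q → s * (a * q) ≡ a * (s * q)
  regroup = solve 3 (λ s a q → s :* (a :* q) := a :* (s :* q)) refl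

sum-cong≤ : ∀ n {f g : ℕ → ℚ} → (∀ i → i ≤ n → f i ≡ g i) → sumTo n f ≡ sumTo n g
sum-cong≤ zero    eq = eq 0 z≤n
sum-cong≤ (suc n) eq = cong₂ _+_ (sum-cong≤ n (λ i i≤n → eq i (ℕP.m≤n⇒m≤1+n i≤n))) (eq (suc n) ℕP.≤-refl)

sum-cong : ∀ n {f g : ℕ → ℚ} → (∀ i → f i ≡ g i) → sumTo n f ≡ sumTo n g
sum-cong n eq = sum-cong≤ n (λ i _ → eq i)

sum-+ : ∀ n (f g : ℕ → ℚ) → sumTo n (λ i → f i + g i) ≡ sumTo n f + sumTo n g
sum-+ zero    f g = refl
sum-+ (suc n) f g = trans (cong (_+ (f (suc n) + g (suc n))) (sum-+ n f g))
                      (interchange (sumTo n f) (sumTo n g) (f (suc n)) (g (suc n)))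
  where
  open ℚSolver.+-*-Solver
  interchange : ∀ a b c d → (a + b) + (c + d) ≡ (a + c) + (b + d)
  interchange = solve 4 (λ a b c d → (a :+ b) :+ (c :+ d) := (a :+ c) :+ (b :+ d)) refl

sum-*ˡ : ∀ n c (f : ℕ → ℚ) → sumTo n (λ i → c * f i) ≡ c * sumTo n f
sum-*ˡ zero    c f = refl
sum-*ˡ (suc n) c f = trans (cong (_+ (c * f (suc n))) (sum-*ˡ n c f)) (sym (ℚP.*-distribˡ-+ c _ _))

sum-*ʳ : ∀ n c (f : ℕ → ℚ) → sumTo n (λ i → f i * c) ≡ sumTo n f * c
sum-*ʳ n c f = trans (sum-cong n (λ i → ℚP.*-comm (f i) c)) (trans (sum-*ˡ n c f) (ℚP.*-comm c _))

sum-neg : ∀ n (f : ℕ → ℚ) → sumTo n (λ i → - f i) ≡ - sumTo n f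
sum-neg zero    f = refl
sum-neg (suc n) f = trans (cong (_+ (- f (suc n))) (sum-neg n f)) (sym (ℚP.neg-distrib-+ (sumTo n f) (f (suc n))))

sum-zero : ∀ n {f : ℕ → ℚ} → (∀ i → i ≤ n → f i ≡ 0ℚ) → sumTo n f ≡ 0ℚ
sum-zero zero    eq = eq 0 z≤n
sum-zero (suc n) eq = trans (cong₂ _+_ (sum-zero n (λ i i≤n → eq i (ℕP.m≤n⇒m≤1+n i≤n))) (eq (suc n) ℕP.≤-refl))
                        (ℚP.+-identityˡ 0ℚ)

sum-shift : ∀ n (f : ℕ → ℚ) → sumTo (suc n) f ≡ f 0 + sumTo n (λ i → f (suc i))
sum-shift zero    f = refl
sum-shift (suc n) f = trans (cong (_+ f (suc (suc n))) (sum-shift n f)) (ℚP.+-assoc (f 0) _ _)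

sum-single : ∀ n {f : ℕ → ℚ} → (∀ i → 1 ≤ i → i ≤ n → f i ≡ 0ℚ) → sumTo n f ≡ f 0
sum-single zero        eq = refl
sum-single (suc n) {f} eq =
  trans (sum-shift n f)
    (trans (cong (f 0 +_) (sum-zero n (λ i i≤n → eq (suc i) (s≤s z≤n) (s≤s i≤n)))) (ℚP.+-identityʳ (f 0)))

sum-reverse : ∀ n (f : ℕ → ℚ) → sumTo n f ≡ sumTo n (λ i → f (n ∸ i))
sum-reverse zero    f = refl
sum-reverse (suc n) f =
  trans (cong (_+ f (suc n)) (sum-reverse n f))
    (trans (ℚP.+-comm (sumTo n (λ i → f (n ∸ i))) (f (suc n))) (sym (sum-shift n (λ i → f (suc n ∸ i)))))

sum-extend : ∀ n m {f : ℕ → ℚ} → n ≤ m → (∀ i → n < i → i ≤ m → f i ≡ 0ℚ) → sumTo m f ≡ sumTo n f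
sum-extend n zero    z≤n  eq = refl
sum-extend n (suc m) n≤1+m eq with ℕP.m≤n⇒m<n∨m≡n n≤1+m
... | inj₁ (s≤s n≤m) = trans (cong₂ _+_ (sum-extend n m n≤m (λ i n<i i≤m → eq i n<i (ℕP.m≤n⇒m≤1+n i≤m)))
                                        (eq (suc m) (s≤s n≤m) ℕP.≤-refl))
                             (ℚP.+-identityʳ _)
... | inj₂ refl = refl

sum-swap : ∀ n m (F : ℕ → ℕ → ℚ) →
           sumTo n (λ i → sumTo m (λ j → F i j)) ≡ sumTo m (λ j → sumTo n (λ i → F i j))
sum-swap zero    m F = refl
sum-swap (suc n) m F = trans (cong (_+ sumTo m (λ j → F (suc n) j)) (sum-swap n m F))
                         (sym (sum-+ m (λ j → sumTo n (λ i → F i j)) (λ j → F (suc n) j)))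

sum-triangle : ∀ n (F : ℕ → ℕ → ℚ) →
               sumTo n (λ i → sumTo (n ∸ i) (λ j → F i j)) ≡ sumTo n (λ k → sumTo k (λ i → F i (k ∸ i)))
sum-triangle zero    F = refl
sum-triangle (suc n) F = begin
  sumTo (suc n) (λ i → sumTo (suc n ∸ i) (F i))
    ≡⟨ cong₂ _+_ (sum-cong≤ n (λ i i≤n → cong (λ t → sumTo t (F i)) (ℕP.+-∸-assoc 1 i≤n)))
                 (cong (λ t → sumTo t (F (suc n))) (ℕP.n∸n≡0 n)) ⟩
  sumTo n (λ i → sumTo (n ∸ i) (F i) + F i (suc (n ∸ i))) + F (suc n) 0
    ≡⟨ cong (_+ F (suc n) 0) (sum-+ n _ _) ⟩
  (rows + diagonal) + F (suc n) 0
    ≡⟨ ℚP.+-assoc rows diagonal (F (suc n) 0) ⟩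
  rows + (diagonal + F (suc n) 0)
    ≡⟨ cong₂ _+_ (sum-triangle n F)
                 (cong₂ _+_ (sum-cong≤ n (λ i i≤n → cong (F i) (sym (ℕP.+-∸-assoc 1 i≤n))))
                            (cong (F (suc n)) (sym (ℕP.n∸n≡0 n)))) ⟩
  sumTo n (λ k → sumTo k (λ i → F i (k ∸ i))) + sumTo (suc n) (λ i → F i (suc n ∸ i))
    ∎
  where
  open ≡-Reasoning
  rows diagonal : ℚ
  rows     = sumTo n (λ i → sumTo (n ∸ i) (F i))
  diagonal = sumTo n (λ i → F i (suc (n ∸ i)))

-- Coefficientwise
-- equality ≐ is the working notion; ≈ wraps it in a record so that the
-- two series are recoverable from the type, as the ring solver requires.

infix 4 _≐_ _≈_

_≐_ : PowerSeries → PowerSeries → Set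
f ≐ g = ∀ n → f n ≡ g n

record _≈_ (f g : PowerSeries) : Set where
  constructor mk≈
  field at : f ≐ g
open _≈_ public

zeroS : PowerSeries
zeroS _ = 0ℚ

negS : PowerSeries → PowerSeries
negS f n = - f n

≈-refl : ∀ f → f ≈ f
≈-refl f = mk≈ (λ n → refl)

≈-sym : ∀ {f g} → f ≈ g → g ≈ f
≈-sym e = mk≈ (λ n → sym (at e n))

≈-trans : ∀ {f g h} → f ≈ g → g ≈ h → f ≈ h
≈-trans e e′ = mk≈ (λ n → trans (at e n) (at e′ n))

≈-isEquivalence : IsEquivalence _≈_
≈-isEquivalence = record { refl = ≈-refl _ ; sym = ≈-sym ; trans = ≈-trans }

⊛-cong : ∀ {f f′ g g′} → f ≐ f′ → g ≐ g′ → f ⊛ g ≐ f′ ⊛ g′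
⊛-cong e e′ n = sum-cong n (λ i → cong₂ _*_ (e i) (e′ (n ∸ i)))

⊛-comm : ∀ f g → f ⊛ g ≐ g ⊛ f
⊛-comm f g n = trans (sum-reverse n _) (sum-cong≤ n (λ i i≤n →
  trans (cong (λ t → f (n ∸ i) * g t) (ℕP.m∸[m∸n]≡n i≤n)) (ℚP.*-comm (f (n ∸ i)) (g i))))

⊛-assoc : ∀ f g h → (f ⊛ g) ⊛ h ≐ f ⊛ (g ⊛ h)
⊛-assoc f g h n = begin
  sumTo n (λ k → sumTo k (λ i → f i * g (k ∸ i)) * h (n ∸ k))
    ≡⟨ sum-cong n (λ k → sym (sum-*ʳ k (h (n ∸ k)) _)) ⟩
  sumTo n (λ k → sumTo k (λ i → f i * g (k ∸ i) * h (n ∸ k)))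
    ≡⟨ sum-cong≤ n (λ k k≤n → sum-cong≤ k (λ i i≤k →
         trans (ℚP.*-assoc (f i) _ _) (cong (λ t → f i * (g (k ∸ i) * h t)) (sym (remaining i k i≤k))))) ⟩
  sumTo n (λ k → sumTo k (λ i → f i * (g (k ∸ i) * h (n ∸ i ∸ (k ∸ i)))))
    ≡⟨ sym (sum-triangle n (λ i j → f i * (g j * h (n ∸ i ∸ j)))) ⟩
  sumTo n (λ i → sumTo (n ∸ i) (λ j → f i * (g j * h (n ∸ i ∸ j))))
    ≡⟨ sum-cong n (λ i → sum-*ˡ (n ∸ i) (f i) _) ⟩
  (f ⊛ (g ⊛ h)) n
    ∎
  where
  open ≡-Reasoning
  remaining : ∀ i k → i ≤ k → n ∸ i ∸ (k ∸ i) ≡ n ∸ k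
  remaining i k i≤k = trans (ℕP.∸-+-assoc n i (k ∸ i)) (cong (n ∸_) (ℕP.m+[n∸m]≡n i≤k))

⊛-identityˡ : ∀ f → oneS ⊛ f ≐ f
⊛-identityˡ f n = trans (sum-single n (λ { (suc i) _ _ → ℚP.*-zeroˡ (f (n ∸ suc i)) })) (ℚP.*-identityˡ (f n))

⊛-zeroˡ : ∀ f → zeroS ⊛ f ≐ zeroS
⊛-zeroˡ f n = sum-zero n (λ i _ → ℚP.*-zeroˡ (f (n ∸ i)))

⊛-distribʳ : ∀ h f g → (f ⊕ g) ⊛ h ≐ (f ⊛ h) ⊕ (g ⊛ h)
⊛-distribʳ h f g n = trans (sum-cong n (λ i → ℚP.*-distribʳ-+ (h (n ∸ i)) (f i) (g i))) (sum-+ n _ _)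

⊕-isCommutativeMonoid : IsCommutativeMonoid _≈_ _⊕_ zeroS
⊕-isCommutativeMonoid = record
  { isMonoid = record
    { isSemigroup = record
      { isMagma = record
        { isEquivalence = ≈-isEquivalence
        ; ∙-cong = λ e e′ → mk≈ (λ n → cong₂ _+_ (at e n) (at e′ n)) }
      ; assoc = λ f g h → mk≈ (λ n → ℚP.+-assoc (f n) (g n) (h n)) }
    ; identity = (λ f → mk≈ (λ n → ℚP.+-identityˡ (f n))) , (λ f → mk≈ (λ n → ℚP.+-identityʳ (f n))) }
  ; comm = λ f g → mk≈ (λ n → ℚP.+-comm (f n) (g n)) }

⊛-isCommutativeMonoid : IsCommutativeMonoid _≈_ _⊛_ oneS
⊛-isCommutativeMonoid = record
  { isMonoid = record
    { isSemigroup = record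
      { isMagma = record { isEquivalence = ≈-isEquivalence ; ∙-cong = λ e e′ → mk≈ (⊛-cong (at e) (at e′)) }
      ; assoc = λ f g h → mk≈ (⊛-assoc f g h) }
    ; identity = (λ f → mk≈ (⊛-identityˡ f)) , (λ f → mk≈ (λ n → trans (⊛-comm f oneS n) (⊛-identityˡ f n))) }
  ; comm = λ f g → mk≈ (⊛-comm f g) }

seriesRing : AlmostCommutativeRing _ _
seriesRing = record
  { Carrier = PowerSeries ; _≈_ = _≈_ ; _+_ = _⊕_ ; _*_ = _⊛_ ; -_ = negS ; 0# = zeroS ; 1# = oneS
  ; isAlmostCommutativeRing = record
    { isCommutativeSemiring = IsCommutativeSemiringˡ.isCommutativeSemiring (record
      { +-isCommutativeMonoid = ⊕-isCommutativeMonoid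
      ; *-isCommutativeMonoid = ⊛-isCommutativeMonoid
      ; distribʳ = λ h f g → mk≈ (⊛-distribʳ h f g)
      ; zeroˡ    = λ f → mk≈ (⊛-zeroˡ f) })
    ; -‿cong = λ e → mk≈ (λ n → cong -_ (at e n))
    ; -‿*-distribˡ = λ f g → mk≈ (λ n → trans (sum-cong n (λ i → sym (ℚP.neg-distribˡ-* (f i) (g (n ∸ i)))))
                                               (sum-neg n _))
    ; -‿+-comm = λ f g → mk≈ (λ n → sym (ℚP.neg-distrib-+ (f n) (g n))) } }

-- Rational constants embed as constant series; this makes the ring solver
-- available for identities between series with rational coefficients.
κ : ℚ → PowerSeries
κ q zero    = q
κ q (suc _) = 0ℚ

κ-⊛ : ∀ q f → κ q ⊛ f ≐ q · f
κ-⊛ q f n = sum-single n (λ { (suc i) _ _ → ℚP.*-zeroˡ (f (n ∸ suc i)) })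

κ-+ : ∀ a b → κ (a + b) ≐ κ a ⊕ κ b
κ-+ a b zero    = refl
κ-+ a b (suc n) = sym (ℚP.+-identityˡ 0ℚ)

oneS≐κ1 : oneS ≐ κ 1ℚ
oneS≐κ1 zero    = refl
oneS≐κ1 (suc n) = refl

κ-homomorphism : ℚ.+-*-rawRing -Raw-AlmostCommutative⟶ seriesRing
κ-homomorphism = record
  { ⟦_⟧    = κ
  ; +-homo = λ a b → mk≈ (κ-+ a b)
  ; *-homo = λ a b → mk≈ (λ n → sym (trans (κ-⊛ a (κ b) n) (scale a b n)))
  ; -‿homo = λ a → mk≈ (λ { zero → refl ; (suc n) → refl })
  ; 0-homo = mk≈ (λ { zero → refl ; (suc n) → refl })
  ; 1-homo = mk≈ (λ n → sym (oneS≐κ1 n)) }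
  where
  scale : ∀ a b n → a * κ b n ≡ κ (a * b) n
  scale a b zero    = refl
  scale a b (suc n) = ℚP.*-zeroʳ a

κ-equal? : ∀ a b → Maybe (κ a ≈ κ b)
κ-equal? a b with a ℚ.≟ b
... | yes a≡b = just (mk≈ (λ n → cong (λ q → κ q n) a≡b))
... | no _    = nothing

module SeriesSolver = Algebra.Solver.Ring ℚ.+-*-rawRing seriesRing κ-homomorphism κ-equal?

module ≈-Reasoning = SetoidReasoning (AlmostCommutativeRing.setoid seriesRing)

-- Congruence of the ring operations, in a form where Agda infers the series.
infixl 6 _⟨⊕⟩_
infixl 7 _⟨⊛⟩_

_⟨⊕⟩_ : ∀ {f f′ g g′} → f ≈ f′ → g ≈ g′ → f ⊕ g ≈ f′ ⊕ g′
e ⟨⊕⟩ e′ = mk≈ (λ n → cong₂ _+_ (at e n) (at e′ n))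

_⟨⊛⟩_ : ∀ {f f′ g g′} → f ≈ f′ → g ≈ g′ → f ⊛ g ≈ f′ ⊛ g′
e ⟨⊛⟩ e′ = mk≈ (⊛-cong (at e) (at e′))

⟨negS⟩ : ∀ {f g} → f ≈ g → negS f ≈ negS g
⟨negS⟩ e = mk≈ (λ n → cong -_ (at e n))

D : PowerSeries → PowerSeries
D f n = ι n * f n

X : PowerSeries
X (suc zero) = 1ℚ
X _          = 0ℚ

X-⊛-suc : ∀ f n → (X ⊛ f) (suc n) ≡ f n
X-⊛-suc f n =
  trans (sum-shift n (λ i → X i * f (suc n ∸ i)))
    (trans (cong₂ _+_ (ℚP.*-zeroˡ (f (suc n))) (sum-single n (λ { (suc i) _ _ → ℚP.*-zeroˡ (f (n ∸ suc i)) })))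
      (trans (ℚP.+-identityˡ _) (ℚP.*-identityˡ (f n))))

D-injective : ∀ {f g} → D f ≐ D g → f 0 ≡ g 0 → f ≐ g
D-injective eq eq₀ zero    = eq₀
D-injective eq eq₀ (suc n) = ι-cancel n (eq (suc n))

X-⊛-linear : ∀ a b F G n → (X ⊛ (κ a ⊛ F ⊕ κ b ⊛ G)) (suc n) ≡ a * F n + b * G n
X-⊛-linear a b F G n = trans (X-⊛-suc (κ a ⊛ F ⊕ κ b ⊛ G) n) (cong₂ _+_ (κ-⊛ a F n) (κ-⊛ b G n))

-- Uniqueness for the first-order equation  D K = x (a D K + b K):  the
-- coefficient of xⁿ⁺¹ is determined by those of lower degree.
ode-uniqueness : ∀ a b {K} → D K ≐ X ⊛ (κ a ⊛ D K ⊕ κ b ⊛ K) → K 0 ≡ 0ℚ → K ≐ zeroS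
ode-uniqueness a b     eq K₀ zero    = K₀
ode-uniqueness a b {K} eq K₀ (suc n) = ι-cancel n (begin
  ι (suc n) * K (suc n)               ≡⟨ eq (suc n) ⟩
  (X ⊛ (κ a ⊛ D K ⊕ κ b ⊛ K)) (suc n) ≡⟨ X-⊛-linear a b (D K) K n ⟩
  a * (ι n * K n) + b * K n           ≡⟨ cong₂ (λ u v → a * (ι n * u) + b * v) Kₙ≡0 Kₙ≡0 ⟩
  a * (ι n * 0ℚ) + b * 0ℚ             ≡⟨ vanish a (ι n) b (ι (suc n)) ⟩
  ι (suc n) * 0ℚ                      ∎)
  where
  open ≡-Reasoning
  open ℚSolver.+-*-Solver
  Kₙ≡0 : K n ≡ 0ℚ
  Kₙ≡0 = ode-uniqueness a b eq K₀ n
  vanish : ∀ a m b s → a * (m * 0ℚ) + b * 0ℚ ≡ s * 0ℚ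
  vanish = solve 4 (λ a m b s → a :* (m :* con 0ℚ) :+ b :* con 0ℚ := s :* con 0ℚ) refl

D-cong : ∀ {f g} → f ≐ g → D f ≐ D g
D-cong eq n = cong (ι n *_) (eq n)

D-⊕ : ∀ f g → D (f ⊕ g) ≐ D f ⊕ D g
D-⊕ f g n = ℚP.*-distribˡ-+ (ι n) (f n) (g n)

D-neg : ∀ f → D (negS f) ≐ negS (D f)
D-neg f n = sym (ℚP.neg-distribʳ-* (ι n) (f n))

D-κ : ∀ q → D (κ q) ≐ κ 0ℚ
D-κ q zero    = ℚP.*-zeroˡ q
D-κ q (suc n) = ℚP.*-zeroʳ (ι (suc n))

D-X : D X ≐ X
D-X zero          = refl
D-X (suc zero)    = ℚP.*-identityʳ (ι 1)
D-X (suc (suc n)) = ℚP.*-zeroʳ (ι (suc (suc n)))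

-- Leibniz rule: on xⁿ it is the splitting n = i + (n - i).
D-⊛ : ∀ f g → D (f ⊛ g) ≐ D f ⊛ g ⊕ f ⊛ D g
D-⊛ f g n = begin
  ι n * sumTo n (λ i → f i * g (n ∸ i))
    ≡⟨ sym (sum-*ˡ n (ι n) _) ⟩
  sumTo n (λ i → ι n * (f i * g (n ∸ i)))
    ≡⟨ sum-cong≤ n (λ i i≤n → trans (cong (_* (f i * g (n ∸ i))) (split i i≤n))
                                    (distribute (ι i) (ι (n ∸ i)) (f i) (g (n ∸ i)))) ⟩
  sumTo n (λ i → ι i * f i * g (n ∸ i) + f i * (ι (n ∸ i) * g (n ∸ i)))
    ≡⟨ sum-+ n _ _ ⟩
  (D f ⊛ g ⊕ f ⊛ D g) n
    ∎
  where
  open ≡-Reasoning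
  open ℚSolver.+-*-Solver
  split : ∀ i → i ≤ n → ι n ≡ ι i + ι (n ∸ i)
  split i i≤n = sym (trans (ι-+ i (n ∸ i)) (cong ι (ℕP.m+[n∸m]≡n i≤n)))
  distribute : ∀ a b u v → (a + b) * (u * v) ≡ a * u * v + u * (b * v)
  distribute = solve 4 (λ a b u v → (a :+ b) :* (u :* v) := a :* u :* v :+ u :* (b :* v)) refl

equal-by-D : ∀ f g → D f ≈ D g → f 0 ≡ g 0 → f ≈ g
equal-by-D f g eq eq₀ = mk≈ (D-injective (at eq) eq₀)

D-κ≈ : ∀ q → D (κ q) ≈ κ 0ℚ
D-κ≈ q = mk≈ (D-κ q)

D-⊕≈ : ∀ f g {f′ g′} → D f ≈ f′ → D g ≈ g′ → D (f ⊕ g) ≈ f′ ⊕ g′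
D-⊕≈ f g Df Dg = mk≈ (λ n → trans (D-⊕ f g n) (cong₂ _+_ (at Df n) (at Dg n)))

D-⊛≈ : ∀ f g {f′ g′} → D f ≈ f′ → D g ≈ g′ → D (f ⊛ g) ≈ f′ ⊛ g ⊕ f ⊛ g′
D-⊛≈ f g Df Dg = mk≈ (λ n → trans (D-⊛ f g n) (cong₂ _+_ (at (Df ⟨⊛⟩ ≈-refl g) n) (at (≈-refl f ⟨⊛⟩ Dg) n)))

D-negS≈ : ∀ f {f′} → D f ≈ f′ → D (negS f) ≈ negS f′
D-negS≈ f Df = mk≈ (λ n → trans (D-neg f n) (cong -_ (at Df n)))

-- Substitution.  combine a P = Σₖ aₖ Pₖ, for a family Pₖ of series of order
-- at least k (so each coefficient is a finite sum); compose f g is the case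
-- Pₖ = gᵏ with g(0) = 0.
combine : (ℕ → ℚ) → (ℕ → PowerSeries) → PowerSeries
combine a P n = sumTo n (λ k → a k * P k n)

HasOrders : (ℕ → PowerSeries) → Set
HasOrders P = ∀ k n → n < k → P k n ≡ 0ℚ

pow-hasOrders : ∀ g → g 0 ≡ 0ℚ → HasOrders (powS g)
pow-hasOrders g g₀ (suc k) n (s≤s n≤k) = sum-zero n term
  where
  below : ∀ {j} → suc j ≤ n → n ∸ suc j < k
  below {j} (s≤s {n = m} _) = ℕP.≤-trans (s≤s (ℕP.m∸n≤m m j)) n≤k
  term : ∀ i → i ≤ n → g i * powS g k (n ∸ i) ≡ 0ℚ
  term zero    _     = trans (cong (_* powS g k n) g₀) (ℚP.*-zeroˡ (powS g k n))
  term (suc j) 1+j≤n = trans (cong (g (suc j) *_) (pow-hasOrders g g₀ k (n ∸ suc j) (below 1+j≤n)))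
                             (ℚP.*-zeroʳ (g (suc j)))

combine-extend : ∀ a P → HasOrders P → ∀ n m → n ≤ m → sumTo m (λ k → a k * P k n) ≡ combine a P n
combine-extend a P orders n m n≤m =
  sum-extend n m n≤m (λ k n<k _ → trans (cong (a k *_) (orders k n n<k)) (ℚP.*-zeroʳ (a k)))

combine-⊛ : ∀ a P h → HasOrders P → combine a P ⊛ h ≐ combine a (λ k → P k ⊛ h)
combine-⊛ a P h orders n = begin
  sumTo n (λ i → combine a P i * h (n ∸ i))
    ≡⟨ sum-cong≤ n (λ i i≤n → cong (_* h (n ∸ i)) (sym (combine-extend a P orders i n i≤n))) ⟩
  sumTo n (λ i → sumTo n (λ k → a k * P k i) * h (n ∸ i))
    ≡⟨ sum-cong n (λ i → sym (sum-*ʳ n (h (n ∸ i)) _)) ⟩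
  sumTo n (λ i → sumTo n (λ k → a k * P k i * h (n ∸ i)))
    ≡⟨ sum-swap n n _ ⟩
  sumTo n (λ k → sumTo n (λ i → a k * P k i * h (n ∸ i)))
    ≡⟨ sum-cong n (λ k → trans (sum-cong n (λ i → ℚP.*-assoc (a k) (P k i) (h (n ∸ i)))) (sum-*ˡ n (a k) _)) ⟩
  combine a (λ k → P k ⊛ h) n
    ∎
  where open ≡-Reasoning

⊛-hasOrders : ∀ P h → HasOrders P → HasOrders (λ k → P k ⊛ h)
⊛-hasOrders P h orders k n n<k = sum-zero n (λ i i≤n →
  trans (cong (_* h (n ∸ i)) (orders k i (ℕP.≤-<-trans i≤n n<k))) (ℚP.*-zeroˡ (h (n ∸ i))))

combine-peel : ∀ a P → HasOrders P → combine a P ≐ a 0 · P 0 ⊕ combine (λ k → a (suc k)) (λ k → P (suc k))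
combine-peel a P orders n = trans (sym (combine-extend a P orders n (suc n) (ℕP.n≤1+n n))) (sum-shift n _)

D-hasOrders : ∀ P → HasOrders P → HasOrders (λ k → D (P k))
D-hasOrders P orders k n n<k = trans (cong (ι n *_) (orders k n n<k)) (ℚP.*-zeroʳ (ι n))

D-combine : ∀ a P → D (combine a P) ≐ combine a (λ k → D (P k))
D-combine a P n = trans (sym (sum-*ˡ n (ι n) _)) (sum-cong n (λ k →
  trans (sym (ℚP.*-assoc (ι n) (a k) _)) (trans (cong (_* P k n) (ℚP.*-comm (ι n) (a k))) (ℚP.*-assoc (a k) (ι n) _))))

combine-cong : ∀ {a b P Q} → (∀ k → a k ≡ b k) → (∀ k → P k ≐ Q k) → combine a P ≐ combine b Q
combine-cong ea eP n = sum-cong n (λ k → cong₂ _*_ (ea k) (eP k n))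

combine-weight : ∀ a P → combine a (λ k → ι k · P k) ≐ combine (D a) P
combine-weight a P n = sum-cong n (λ k →
  trans (sym (ℚP.*-assoc (a k) (ι k) _)) (cong (_* P k n) (ℚP.*-comm (a k) (ι k))))

-- D(gᵏ) · g = k gᵏ D g  (the power rule, multiplied by g so that k = 0 needs
-- no special case).
D-pow : ∀ g k → D (powS g k) ⊛ g ≈ ι k · (powS g k ⊛ D g)
D-pow g zero = mk≈ (λ n → begin
  (D oneS ⊛ g) n      ≡⟨ ⊛-cong {D oneS} {κ 0ℚ} {g} {g} (λ m → trans (D-cong oneS≐κ1 m) (D-κ 1ℚ m)) (λ m → refl) n ⟩
  (κ 0ℚ ⊛ g) n        ≡⟨ κ-⊛ 0ℚ g n ⟩
  0ℚ * g n            ≡⟨ ℚP.*-zeroˡ (g n) ⟩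
  0ℚ                  ≡⟨ sym (ℚP.*-zeroˡ ((oneS ⊛ D g) n)) ⟩
  0ℚ * (oneS ⊛ D g) n ∎)
  where open ≡-Reasoning
D-pow g (suc k) = begin
  D (g ⊛ G) ⊛ g
    ≈⟨ mk≈ (D-⊛ g G) ⟨⊛⟩ ≈-refl g ⟩
  (D g ⊛ G ⊕ g ⊛ D G) ⊛ g
    ≈⟨ solve 4 (λ a b c d → (a :* b :+ c :* d) :* c := a :* b :* c :+ c :* (d :* c)) (≈-refl _) (D g) G g (D G) ⟩
  D g ⊛ G ⊛ g ⊕ g ⊛ (D G ⊛ g)
    ≈⟨ ≈-refl (D g ⊛ G ⊛ g) ⟨⊕⟩ (≈-refl g ⟨⊛⟩ D-pow g k) ⟩
  D g ⊛ G ⊛ g ⊕ g ⊛ (ι k · (G ⊛ D g))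
    ≈⟨ ≈-refl (D g ⊛ G ⊛ g) ⟨⊕⟩ (≈-refl g ⟨⊛⟩ mk≈ (λ n → sym (κ-⊛ (ι k) (G ⊛ D g) n))) ⟩
  D g ⊛ G ⊛ g ⊕ g ⊛ (κ (ι k) ⊛ (G ⊛ D g))
    ≈⟨ solve 4 (λ a b c e → a :* b :* c :+ c :* (e :* (b :* a)) := (con 1ℚ :+ e) :* (c :* b :* a))
               (≈-refl _) (D g) G g (κ (ι k)) ⟩
  (κ 1ℚ ⊕ κ (ι k)) ⊛ (g ⊛ G ⊛ D g)
    ≈⟨ mk≈ (λ n → sym (κ-+ 1ℚ (ι k) n)) ⟨⊛⟩ ≈-refl (g ⊛ G ⊛ D g) ⟩
  κ (1ℚ + ι k) ⊛ (g ⊛ G ⊛ D g)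
    ≈⟨ mk≈ (κ-⊛ (1ℚ + ι k) _) ⟩
  (1ℚ + ι k) · (g ⊛ G ⊛ D g)
    ≈⟨ mk≈ (λ n → cong (_* (g ⊛ G ⊛ D g) n) (ι-+ 1 k)) ⟩
  ι (suc k) · (g ⊛ G ⊛ D g)
    ∎
  where
  open ≈-Reasoning
  open SeriesSolver
  G : PowerSeries
  G = powS g k

chain-rule : ∀ f g → g 0 ≡ 0ℚ → D (compose f g) ⊛ g ≐ compose (D f) g ⊛ D g
chain-rule f g g₀ n = begin
  (D (combine f (powS g)) ⊛ g) n
    ≡⟨ ⊛-cong {g = g} {g′ = g} (D-combine f (powS g)) (λ m → refl) n ⟩
  (combine f (λ k → D (powS g k)) ⊛ g) n
    ≡⟨ combine-⊛ f (λ k → D (powS g k)) g (D-hasOrders (powS g) g-orders) n ⟩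
  combine f (λ k → D (powS g k) ⊛ g) n
    ≡⟨ combine-cong {f} {f} (λ k → refl) (λ k → at (D-pow g k)) n ⟩
  combine f (λ k → ι k · (powS g k ⊛ D g)) n
    ≡⟨ combine-weight f (λ k → powS g k ⊛ D g) n ⟩
  combine (D f) (λ k → powS g k ⊛ D g) n
    ≡⟨ sym (combine-⊛ (D f) (powS g) (D g) g-orders n) ⟩
  (combine (D f) (powS g) ⊛ D g) n
    ∎
  where
  open ≡-Reasoning
  g-orders : HasOrders (powS g)
  g-orders = pow-hasOrders g g₀

-- A series g = x + O(x²) is not a zero divisor: g f = g h forces f = h, the
-- coefficient of xᵐ⁺¹ in g f being f m plus terms in f 0, …, f (m-1).
module _ (g : PowerSeries) (g₀ : g 0 ≡ 0ℚ) (g₁ : g 1 ≡ 1ℚ) where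

  private
    tail : PowerSeries → ℕ → ℚ
    tail f m = sumTo m (λ i → g (suc (suc i)) * f (m ∸ i))

    leading : ∀ (f : PowerSeries) m → g 1 * f m ≡ f m
    leading f m = trans (cong (_* f m) g₁) (ℚP.*-identityˡ (f m))

    ⊛-coeff : ∀ (f : PowerSeries) m → (g ⊛ f) (suc m) ≡ sumTo m (λ i → g (suc i) * f (m ∸ i))
    ⊛-coeff f m = trans (sum-shift m (λ i → g i * f (suc m ∸ i)))
                    (trans (cong (_+ rest) (trans (cong (_* f (suc m)) g₀) (ℚP.*-zeroˡ (f (suc m)))))
                      (ℚP.+-identityˡ rest))
      where
      rest : ℚ
      rest = sumTo m (λ i → g (suc i) * f (m ∸ i))

    ⊛-coeff-suc : ∀ (f : PowerSeries) m → (g ⊛ f) (suc (suc m)) ≡ f (suc m) + tail f m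
    ⊛-coeff-suc f m = trans (⊛-coeff f (suc m))
      (trans (sum-shift m (λ i → g (suc i) * f (suc m ∸ i))) (cong (_+ tail f m) (leading f (suc m))))

    cancel-upto : ∀ f h → g ⊛ f ≐ g ⊛ h → ∀ m j → j ≤ m → f j ≡ h j
    cancel-upto f h eq zero .zero z≤n = begin
      f 0             ≡⟨ sym (leading f 0) ⟩
      g 1 * f 0       ≡⟨ sym (⊛-coeff f 0) ⟩
      (g ⊛ f) 1       ≡⟨ eq 1 ⟩
      (g ⊛ h) 1       ≡⟨ ⊛-coeff h 0 ⟩
      g 1 * h 0       ≡⟨ leading h 0 ⟩
      h 0             ∎
      where open ≡-Reasoning
    cancel-upto f h eq (suc m) j j≤1+m with ℕP.m≤n⇒m<n∨m≡n j≤1+m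
    ... | inj₁ (s≤s j≤m) = cancel-upto f h eq m j j≤m
    ... | inj₂ refl = +-cancelʳ (tail h m) (f (suc m)) (h (suc m)) (begin
      f (suc m) + tail h m    ≡⟨ cong (f (suc m) +_) (sym same-tail) ⟩
      f (suc m) + tail f m    ≡⟨ sym (⊛-coeff-suc f m) ⟩
      (g ⊛ f) (suc (suc m))   ≡⟨ eq (suc (suc m)) ⟩
      (g ⊛ h) (suc (suc m))   ≡⟨ ⊛-coeff-suc h m ⟩
      h (suc m) + tail h m    ∎)
      where
      open ≡-Reasoning
      same-tail : tail f m ≡ tail h m
      same-tail = sum-cong m (λ i → cong (g (suc (suc i)) *_) (cancel-upto f h eq m (m ∸ i) (ℕP.m∸n≤m m i)))

  ⊛-cancelˡ : ∀ {f h} → g ⊛ f ≈ g ⊛ h → f ≈ h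
  ⊛-cancelˡ {f} {h} eq = mk≈ (λ n → cancel-upto f h (at eq) n n ℕP.≤-refl)

B : PowerSeries
B k = ι ((2 ℕ.* k) C k)

S₁ : PowerSeries
S₁ zero    = 0ℚ
S₁ (suc k) = B (suc k) * recip (suc k)

S₂ : PowerSeries
S₂ zero    = 0ℚ
S₂ (suc k) = B (suc k) * recip (suc k ℕ.* suc k)

BH : PowerSeries
BH k = B k * H2 k

Lβ : ℕ → PowerSeries
Lβ d = compose (Li d) β

D-β : D β ≐ X ⊛ B
D-β zero    = refl
D-β (suc k) = begin
  ι (suc k) * β (suc k)             ≡⟨ cong (ι (suc k) *_) (/≡ι*recip ((2 ℕ.* k) C k) (suc k)) ⟩
  ι (suc k) * (B k * recip (suc k)) ≡⟨ cancel-recip (B k) k ⟩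
  B k                               ≡⟨ sym (X-⊛-suc B k) ⟩
  (X ⊛ B) (suc k)                   ∎
  where open ≡-Reasoning

D-Li : ∀ d → D (Li (suc d)) ≐ Li d
D-Li d zero    = refl
D-Li d (suc m) = begin
  ι (suc m) * Li (suc d) (suc m)
    ≡⟨ cong (ι (suc m) *_) (recip-* (suc m) (suc m ℕ.^ d) {{_}} {{ℕP.m^n≢0 (suc m) d}}) ⟩
  ι (suc m) * (recip (suc m) * Li d (suc m))
    ≡⟨ sym (ℚP.*-assoc (ι (suc m)) (recip (suc m)) (Li d (suc m))) ⟩
  ι (suc m) * recip (suc m) * Li d (suc m)
    ≡⟨ cong (_* Li d (suc m)) (ι*recip (suc m)) ⟩
  1ℚ * Li d (suc m)
    ≡⟨ ℚP.*-identityˡ (Li d (suc m)) ⟩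
  Li d (suc m)
    ∎
  where open ≡-Reasoning

central-recurrenceℚ : ∀ n → (ι 4 * ι n + ι 2) * B n ≡ ι (suc n) * B (suc n)
central-recurrenceℚ n = begin
  (ι 4 * ι n + ι 2) * B n                 ≡⟨ cong (λ t → (t + ι 2) * B n) (ι-* 4 n) ⟩
  (ι (4 ℕ.* n) + ι 2) * B n               ≡⟨ cong (_* B n) (ι-+ (4 ℕ.* n) 2) ⟩
  ι (4 ℕ.* n ℕ.+ 2) * B n                 ≡⟨ ι-* (4 ℕ.* n ℕ.+ 2) ((2 ℕ.* n) C n) ⟩
  ι ((4 ℕ.* n ℕ.+ 2) ℕ.* ((2 ℕ.* n) C n)) ≡⟨ cong ι (sym (central-recurrence n)) ⟩
  ι (suc n ℕ.* ((2 ℕ.* suc n) C suc n))   ≡⟨ sym (ι-* (suc n) ((2 ℕ.* suc n) C suc n)) ⟩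
  ι (suc n) * B (suc n)                   ∎
  where open ≡-Reasoning

D-B : D B ≐ X ⊛ (κ (ι 4) ⊛ D B ⊕ κ (ι 2) ⊛ B)
D-B zero    = refl
D-B (suc n) = sym (begin
  (X ⊛ (κ (ι 4) ⊛ D B ⊕ κ (ι 2) ⊛ B)) (suc n) ≡⟨ X-⊛-linear (ι 4) (ι 2) (D B) B n ⟩
  ι 4 * (ι n * B n) + ι 2 * B n               ≡⟨ factor (ι 4) (ι n) (ι 2) (B n) ⟩
  (ι 4 * ι n + ι 2) * B n                     ≡⟨ central-recurrenceℚ n ⟩
  ι (suc n) * B (suc n)                       ∎)
  where
  open ≡-Reasoning
  open ℚSolver.+-*-Solver
  factor : ∀ a m c b → a * (m * b) + c * b ≡ (a * m + c) * b
  factor = solve 4 (λ a m c b → a :* (m :* b) :+ c :* b := (a :* m :+ c) :* b) refl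

D-S₁ : D S₁ ≐ B ⊕ negS (κ 1ℚ)
D-S₁ zero    = refl
D-S₁ (suc k) = trans (cancel-recip (B (suc k)) k) (sym (ℚP.+-identityʳ (B (suc k))))

D-S₂ : D S₂ ≐ S₁
D-S₂ zero    = refl
D-S₂ (suc k) = begin
  ι (suc k) * (B (suc k) * recip (suc k ℕ.* suc k))
    ≡⟨ cong (λ t → ι (suc k) * (B (suc k) * t)) (recip-* (suc k) (suc k)) ⟩
  ι (suc k) * (B (suc k) * (recip (suc k) * recip (suc k)))
    ≡⟨ cong (ι (suc k) *_) (sym (ℚP.*-assoc (B (suc k)) (recip (suc k)) (recip (suc k)))) ⟩
  ι (suc k) * (B (suc k) * recip (suc k) * recip (suc k))
    ≡⟨ cancel-recip (B (suc k) * recip (suc k)) k ⟩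
  B (suc k) * recip (suc k)
    ∎
  where open ≡-Reasoning

-- Since H_{n+1}^{(2)} = H_n^{(2)} + 1/(n+1)², BH satisfies the recurrence of B
-- with the inhomogeneous term S₁:  D BH = x (4 D BH + 2 BH) + S₁.
D-BH : D BH ≐ X ⊛ (κ (ι 4) ⊛ D BH ⊕ κ (ι 2) ⊛ BH) ⊕ S₁
D-BH zero    = refl
D-BH (suc n) = sym (begin
  (X ⊛ (κ (ι 4) ⊛ D BH ⊕ κ (ι 2) ⊛ BH)) (suc n) + S₁ (suc n)
    ≡⟨ cong (_+ S₁ (suc n)) (X-⊛-linear (ι 4) (ι 2) (D BH) BH n) ⟩
  ι 4 * (ι n * (B n * H)) + ι 2 * (B n * H) + B′ * q
    ≡⟨ factor (ι 4) (ι n) (ι 2) (B n) H (B′ * q) ⟩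
  (ι 4 * ι n + ι 2) * B n * H + B′ * q
    ≡⟨ cong (λ t → t * H + B′ * q) (central-recurrenceℚ n) ⟩
  s * B′ * H + B′ * q
    ≡⟨ cong (λ t → s * B′ * H + B′ * t) q≡q*s*q ⟩
  s * B′ * H + B′ * (q * s * q)
    ≡⟨ regroup s B′ H q ⟩
  s * (B′ * (H + q * q))
    ≡⟨ cong (λ t → s * (B′ * (H + t))) (sym (recip-* (suc n) (suc n))) ⟩
  D BH (suc n)
    ∎)
  where
  open ≡-Reasoning
  open ℚSolver.+-*-Solver
  B′ H q s : ℚ
  B′ = B (suc n)
  H  = H2 n
  q  = recip (suc n)
  s  = ι (suc n)
  q≡q*s*q : q ≡ q * s * q
  q≡q*s*q = sym (trans (cong (_* q) (trans (ℚP.*-comm q s) (ι*recip (suc n)))) (ℚP.*-identityˡ q))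
  factor : ∀ a m c b H r → a * (m * (b * H)) + c * (b * H) + r ≡ (a * m + c) * b * H + r
  factor = solve 6 (λ a m c b H r → a :* (m :* (b :* H)) :+ c :* (b :* H) :+ r := (a :* m :+ c) :* b :* H :+ r) refl
  regroup : ∀ s b H q → s * b * H + b * (q * s * q) ≡ s * (b * (H + q * q))
  regroup = solve 4 (λ s b H q → s :* b :* H :+ b :* (q :* s :* q) := s :* (b :* (H :+ q :* q))) refl

D-lhs : D lhsSeries ≐ BH ⊕ S₂
D-lhs zero    = refl
D-lhs (suc m) = begin
  s * (b * (H * q + recip (suc m ℕ.* suc m ℕ.* suc m)))
    ≡⟨ cong (λ t → s * (b * (H * q + t)))
            (trans (recip-* (suc m ℕ.* suc m) (suc m)) (cong (_* q) (recip-* (suc m) (suc m)))) ⟩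
  s * (b * (H * q + q * q * q))
    ≡⟨ regroup s b H q ⟩
  b * H * (s * q) + b * (q * q) * (s * q)
    ≡⟨ cong₂ (λ u v → b * H * u + b * (q * q) * v) (ι*recip (suc m)) (ι*recip (suc m)) ⟩
  b * H * 1ℚ + b * (q * q) * 1ℚ
    ≡⟨ cong₂ _+_ (ℚP.*-identityʳ (b * H))
                 (trans (ℚP.*-identityʳ (b * (q * q))) (cong (b *_) (sym (recip-* (suc m) (suc m))))) ⟩
  (BH ⊕ S₂) (suc m)
    ∎
  where
  open ≡-Reasoning
  open ℚSolver.+-*-Solver
  b H q s : ℚ
  b = B (suc m)
  H = H2 (suc m)
  q = recip (suc m)
  s = ι (suc m)
  regroup : ∀ s b H q → s * (b * (H * q + q * q * q)) ≡ b * H * (s * q) + b * (q * q) * (s * q)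
  regroup = solve 4 (λ s b H q → s :* (b :* (H :* q :+ q :* q :* q)) := b :* H :* (s :* q) :+ b :* (q :* q) :* (s :* q)) refl

one-minus : ℚ → PowerSeries → PowerSeries
one-minus c g = κ 1ℚ ⊕ negS (κ c ⊛ g)

D-one-minus : ∀ c g {g′} → D g ≈ g′ → D (one-minus c g) ≈ negS (κ c ⊛ g′)
D-one-minus c g {g′} Dg = begin
  D (one-minus c g)
    ≈⟨ D-⊕≈ (κ 1ℚ) (negS (κ c ⊛ g)) (D-κ≈ 1ℚ) (D-negS≈ (κ c ⊛ g) (D-⊛≈ (κ c) g (D-κ≈ c) Dg)) ⟩
  κ 0ℚ ⊕ negS (κ 0ℚ ⊛ g ⊕ κ c ⊛ g′)
    ≈⟨ solve 2 (λ g g′ → con 0ℚ :- (con 0ℚ :* g :+ con c :* g′) := :- (con c :* g′)) (≈-refl _) g g′ ⟩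
  negS (κ c ⊛ g′)
    ∎
  where
  open ≈-Reasoning
  open SeriesSolver

1-4x 1-2β 1-β : PowerSeries
1-4x = one-minus (ι 4) X
1-2β = one-minus (ι 2) β
1-β  = one-minus 1ℚ β

-- The differential operator  L f = (1 - 4x) D f - 2x f,  whose solution with
-- constant term 1 is B = (1 - 4x)^{-1/2}.
L : PowerSeries → PowerSeries
L f = 1-4x ⊛ D f ⊕ negS (κ (ι 2) ⊛ X ⊛ f)

L-from-recurrence : ∀ f g → D f ≈ X ⊛ (κ (ι 4) ⊛ D f ⊕ κ (ι 2) ⊛ f) ⊕ g → L f ≈ g
L-from-recurrence f g eq = begin
  L f
    ≈⟨ solve 3 (λ x d f → (con 1ℚ :- con (ι 4) :* x) :* d :- con (ι 2) :* x :* f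
                        := d :- (con (ι 4) :* x :* d :+ con (ι 2) :* x :* f)) (≈-refl _) X (D f) f ⟩
  D f ⊕ negS (κ (ι 4) ⊛ X ⊛ D f ⊕ κ (ι 2) ⊛ X ⊛ f)
    ≈⟨ eq ⟨⊕⟩ ≈-refl _ ⟩
  X ⊛ (κ (ι 4) ⊛ D f ⊕ κ (ι 2) ⊛ f) ⊕ g ⊕ negS (κ (ι 4) ⊛ X ⊛ D f ⊕ κ (ι 2) ⊛ X ⊛ f)
    ≈⟨ solve 4 (λ x d f g → x :* (con (ι 4) :* d :+ con (ι 2) :* f) :+ g :- (con (ι 4) :* x :* d :+ con (ι 2) :* x :* f)
                          := g) (≈-refl _) X (D f) f g ⟩
  g
    ∎
  where
  open ≈-Reasoning
  open SeriesSolver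

-- L is injective up to the constant term, by ode-uniqueness applied to f - g.
L-injective : ∀ f g → L f ≈ L g → f 0 ≡ g 0 → f ≈ g
L-injective f g Lf≈Lg eq₀ = mk≈ (λ n → difference-zero (f n) (g n) (K≐0 n))
  where
  open ≈-Reasoning
  open SeriesSolver
  K : PowerSeries
  K = f ⊕ negS g
  DK : D K ≈ D f ⊕ negS (D g)
  DK = D-⊕≈ f (negS g) (≈-refl _) (D-negS≈ g (≈-refl _))
  recurrence : D K ≈ X ⊛ (κ (ι 4) ⊛ D K ⊕ κ (ι 2) ⊛ K)
  recurrence = begin
    D K
      ≈⟨ DK ⟩
    D f ⊕ negS (D g)
      ≈⟨ solve 5 (λ x d e f g → d :- e := (con 1ℚ :- con (ι 4) :* x) :* d :- con (ι 2) :* x :* f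
                                          :- ((con 1ℚ :- con (ι 4) :* x) :* e :- con (ι 2) :* x :* g)
                                          :+ x :* (con (ι 4) :* (d :- e) :+ con (ι 2) :* (f :- g)))
                 (≈-refl _) X (D f) (D g) f g ⟩
    L f ⊕ negS (L g) ⊕ X ⊛ (κ (ι 4) ⊛ (D f ⊕ negS (D g)) ⊕ κ (ι 2) ⊛ K)
      ≈⟨ (Lf≈Lg ⟨⊕⟩ ≈-refl (negS (L g))) ⟨⊕⟩ (≈-refl X ⟨⊛⟩ ((≈-refl (κ (ι 4)) ⟨⊛⟩ ≈-sym DK) ⟨⊕⟩ ≈-refl (κ (ι 2) ⊛ K))) ⟩
    L g ⊕ negS (L g) ⊕ X ⊛ (κ (ι 4) ⊛ D K ⊕ κ (ι 2) ⊛ K)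
      ≈⟨ solve 2 (λ l r → l :- l :+ r := r) (≈-refl _) (L g) (X ⊛ (κ (ι 4) ⊛ D K ⊕ κ (ι 2) ⊛ K)) ⟩
    X ⊛ (κ (ι 4) ⊛ D K ⊕ κ (ι 2) ⊛ K)
      ∎
  K≐0 : K ≐ zeroS
  K≐0 = ode-uniqueness (ι 4) (ι 2) (at recurrence)
          (trans (cong (λ t → f 0 + - t) (sym eq₀)) (ℚP.+-inverseʳ (f 0)))

L-B : L B ≈ κ 0ℚ
L-B = L-from-recurrence B (κ 0ℚ) (mk≈ λ
  { zero    → refl
  ; (suc n) → trans (D-B (suc n)) (sym (ℚP.+-identityʳ _)) })

L-BH : L BH ≈ S₁
L-BH = L-from-recurrence BH S₁ (mk≈ D-BH)

-- B² (1 - 4x) = 1:  its image under D is 2B · L B = 0.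
B²-identity : B ⊛ B ⊛ 1-4x ≈ κ 1ℚ
B²-identity = equal-by-D (B ⊛ B ⊛ 1-4x) (κ 1ℚ) (begin
  D (B ⊛ B ⊛ 1-4x)
    ≈⟨ D-⊛≈ (B ⊛ B) 1-4x (D-⊛≈ B B (≈-refl _) (≈-refl _)) (D-one-minus (ι 4) X (mk≈ D-X)) ⟩
  (D B ⊛ B ⊕ B ⊛ D B) ⊛ 1-4x ⊕ B ⊛ B ⊛ negS (κ (ι 4) ⊛ X)
    ≈⟨ solve 3 (λ d b x → (d :* b :+ b :* d) :* (con 1ℚ :- con (ι 4) :* x) :+ b :* b :* (:- (con (ι 4) :* x))
                        := con (ι 2) :* b :* ((con 1ℚ :- con (ι 4) :* x) :* d :- con (ι 2) :* x :* b))
               (≈-refl _) (D B) B X ⟩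
  κ (ι 2) ⊛ B ⊛ L B
    ≈⟨ ≈-refl (κ (ι 2) ⊛ B) ⟨⊛⟩ L-B ⟩
  κ (ι 2) ⊛ B ⊛ κ 0ℚ
    ≈⟨ solve 1 (λ b → con (ι 2) :* b :* con 0ℚ := con 0ℚ) (≈-refl _) B ⟩
  κ 0ℚ
    ≈⟨ ≈-sym (D-κ≈ 1ℚ) ⟩
  D (κ 1ℚ)
    ∎) refl
  where
  open ≈-Reasoning
  open SeriesSolver

-- B (1 - 2β) = 1, i.e. B = 1/√(1-4x) and 1 - 2β = √(1-4x):  both sides
-- satisfy L f = -2x.
B-1-2β : B ⊛ 1-2β ≈ κ 1ℚ
B-1-2β = L-injective (B ⊛ 1-2β) (κ 1ℚ) (begin
  L (B ⊛ 1-2β)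
    ≈⟨ (≈-refl 1-4x ⟨⊛⟩ D-⊛≈ B 1-2β (≈-refl _) (D-one-minus (ι 2) β (mk≈ D-β))) ⟨⊕⟩ ≈-refl _ ⟩
  1-4x ⊛ (D B ⊛ 1-2β ⊕ B ⊛ negS (κ (ι 2) ⊛ (X ⊛ B))) ⊕ negS (κ (ι 2) ⊛ X ⊛ (B ⊛ 1-2β))
    ≈⟨ solve 4 (λ d b x β → (con 1ℚ :- con (ι 4) :* x) :* (d :* (con 1ℚ :- con (ι 2) :* β) :+ b :* (:- (con (ι 2) :* (x :* b))))
                             :- con (ι 2) :* x :* (b :* (con 1ℚ :- con (ι 2) :* β))
                          := (con 1ℚ :- con (ι 2) :* β) :* ((con 1ℚ :- con (ι 4) :* x) :* d :- con (ι 2) :* x :* b)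
                             :- con (ι 2) :* x :* (b :* b :* (con 1ℚ :- con (ι 4) :* x)))
               (≈-refl _) (D B) B X β ⟩
  1-2β ⊛ L B ⊕ negS (κ (ι 2) ⊛ X ⊛ (B ⊛ B ⊛ 1-4x))
    ≈⟨ (≈-refl 1-2β ⟨⊛⟩ L-B) ⟨⊕⟩ ⟨negS⟩ (≈-refl (κ (ι 2) ⊛ X) ⟨⊛⟩ B²-identity) ⟩
  1-2β ⊛ κ 0ℚ ⊕ negS (κ (ι 2) ⊛ X ⊛ κ 1ℚ)
    ≈⟨ solve 2 (λ x β → (con 1ℚ :- con (ι 2) :* β) :* con 0ℚ :- con (ι 2) :* x :* con 1ℚ
                      := (con 1ℚ :- con (ι 4) :* x) :* con 0ℚ :- con (ι 2) :* x :* con 1ℚ) (≈-refl _) X β ⟩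
  1-4x ⊛ κ 0ℚ ⊕ negS (κ (ι 2) ⊛ X ⊛ κ 1ℚ)
    ≈⟨ (≈-refl 1-4x ⟨⊛⟩ ≈-sym (D-κ≈ 1ℚ)) ⟨⊕⟩ ≈-refl _ ⟩
  L (κ 1ℚ)
    ∎) refl
  where
  open ≈-Reasoning
  open SeriesSolver

-- β (1 - β) = x:  the image under D is x B (1 - 2β) = x.
β-quadratic : β ⊛ 1-β ≈ X
β-quadratic = equal-by-D (β ⊛ 1-β) X (begin
  D (β ⊛ 1-β)
    ≈⟨ D-⊛≈ β 1-β (mk≈ D-β) (D-one-minus 1ℚ β (mk≈ D-β)) ⟩
  X ⊛ B ⊛ 1-β ⊕ β ⊛ negS (κ 1ℚ ⊛ (X ⊛ B))
    ≈⟨ solve 3 (λ x b β → x :* b :* (con 1ℚ :- con 1ℚ :* β) :+ β :* (:- (con 1ℚ :* (x :* b)))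
                        := x :* (b :* (con 1ℚ :- con (ι 2) :* β))) (≈-refl _) X B β ⟩
  X ⊛ (B ⊛ 1-2β)
    ≈⟨ ≈-refl X ⟨⊛⟩ B-1-2β ⟩
  X ⊛ κ 1ℚ
    ≈⟨ solve 1 (λ x → x :* con 1ℚ := x) (≈-refl _) X ⟩
  X
    ≈⟨ ≈-sym (mk≈ D-X) ⟩
  D X
    ∎) refl
  where
  open ≈-Reasoning
  open SeriesSolver

-- D Li_{d+1}(β) = Li_d(β) (1 - β) B:  by the chain rule D Li_{d+1}(β) · β =
-- Li_d(β) · x B = Li_d(β) · β (1 - β) B, and β = x + O(x²) may be cancelled.
D-Lβ : ∀ d → D (Lβ (suc d)) ≈ Lβ d ⊛ 1-β ⊛ B
D-Lβ d = ⊛-cancelˡ β refl refl (begin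
  β ⊛ D (Lβ (suc d))               ≈⟨ solve 2 (λ β u → β :* u := u :* β) (≈-refl _) β (D (Lβ (suc d))) ⟩
  D (Lβ (suc d)) ⊛ β               ≈⟨ mk≈ (chain-rule (Li (suc d)) β refl) ⟩
  compose (D (Li (suc d))) β ⊛ D β ≈⟨ mk≈ (combine-cong (D-Li d) (λ k n → refl)) ⟨⊛⟩ mk≈ D-β ⟩
  Lβ d ⊛ (X ⊛ B)                   ≈⟨ ≈-refl (Lβ d) ⟨⊛⟩ (≈-sym β-quadratic ⟨⊛⟩ ≈-refl B) ⟩
  Lβ d ⊛ (β ⊛ 1-β ⊛ B)             ≈⟨ solve 3 (λ u β b → u :* (β :* (con 1ℚ :- con 1ℚ :* β) :* b)
                                                             := β :* (u :* (con 1ℚ :- con 1ℚ :* β) :* b))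
                                                 (≈-refl _) (Lβ d) β B ⟩
  β ⊛ (Lβ d ⊛ 1-β ⊛ B)                  ∎)
  where
  open ≈-Reasoning
  open SeriesSolver

-- Li₀(t) = t/(1 - t), in the form  Li₀(β) = β + Li₀(β) β:  both sides are
-- Σ_{k≥1} βᵏ after peeling off the first term.
Lβ0-recursion : Lβ 0 ≐ β ⊕ Lβ 0 ⊛ β
Lβ0-recursion n = begin
  Lβ 0 n
    ≡⟨ combine-peel (Li 0) (powS β) β-orders n ⟩
  0ℚ * oneS n + combine one (λ k → powS β (suc k)) n
    ≡⟨ drop-zero (oneS n) (combine one (λ k → powS β (suc k)) n) ⟩
  combine one (λ k → powS β (suc k)) n
    ≡⟨ combine-peel one (λ k → powS β (suc k)) (λ k m m<k → β-orders (suc k) m (ℕP.m<n⇒m<1+n m<k)) n ⟩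
  1ℚ * (β ⊛ oneS) n + combine one (λ k → β ⊛ (β ⊛ powS β k)) n
    ≡⟨ cong₂ _+_ (trans (ℚP.*-identityˡ _) (trans (⊛-comm β oneS n) (⊛-identityˡ β n)))
                 (combine-cong {one} {one} (λ k → refl) (λ k → ⊛-comm β (β ⊛ powS β k)) n) ⟩
  β n + combine one (λ k → (β ⊛ powS β k) ⊛ β) n
    ≡⟨ cong (β n +_) (sym (drop-zero ((oneS ⊛ β) n) (combine one (λ k → (β ⊛ powS β k) ⊛ β) n))) ⟩
  β n + (0ℚ * (oneS ⊛ β) n + combine one (λ k → (β ⊛ powS β k) ⊛ β) n)
    ≡⟨ cong (β n +_) (sym (combine-peel (Li 0) (λ k → powS β k ⊛ β) (⊛-hasOrders (powS β) β β-orders) n)) ⟩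
  β n + combine (Li 0) (λ k → powS β k ⊛ β) n
    ≡⟨ cong (β n +_) (sym (combine-⊛ (Li 0) (powS β) β β-orders n)) ⟩
  β n + (Lβ 0 ⊛ β) n
    ∎
  where
  open ≡-Reasoning
  one : ℕ → ℚ
  one _ = 1ℚ
  β-orders : HasOrders (powS β)
  β-orders = pow-hasOrders β refl
  drop-zero : ∀ p q → 0ℚ * p + q ≡ q
  drop-zero p q = trans (cong (_+ q) (ℚP.*-zeroˡ p)) (ℚP.+-identityˡ q)

Lβ0-closed : Lβ 0 ⊛ 1-β ≈ β
Lβ0-closed = begin
  Lβ 0 ⊛ 1-β                     ≈⟨ solve 2 (λ u β → u :* (con 1ℚ :- con 1ℚ :* β) := u :- u :* β) (≈-refl _) (Lβ 0) β ⟩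
  Lβ 0 ⊕ negS (Lβ 0 ⊛ β)         ≈⟨ mk≈ Lβ0-recursion ⟨⊕⟩ ≈-refl _ ⟩
  β ⊕ Lβ 0 ⊛ β ⊕ negS (Lβ 0 ⊛ β) ≈⟨ solve 2 (λ u β → β :+ u :* β :- u :* β := β) (≈-refl _) (Lβ 0) β ⟩
  β                              ∎
  where
  open ≈-Reasoning
  open SeriesSolver

D-Lβ1 : D (Lβ 1) ≈ β ⊛ B
D-Lβ1 = ≈-trans (D-Lβ 0) (Lβ0-closed ⟨⊛⟩ ≈-refl B)

-- Σ C(2k,k)/k xᵏ = 2 Li₁(β):  under D, B - 1 = 2βB by B (1 - 2β) = 1.
S₁-closed : S₁ ≈ κ (ι 2) ⊛ Lβ 1
S₁-closed = equal-by-D S₁ (κ (ι 2) ⊛ Lβ 1) (begin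
  D S₁
    ≈⟨ mk≈ D-S₁ ⟩
  B ⊕ negS (κ 1ℚ)
    ≈⟨ solve 2 (λ b β → b :- con 1ℚ := b :* (con 1ℚ :- con (ι 2) :* β) :- con 1ℚ :+ con (ι 2) :* (β :* b))
               (≈-refl _) B β ⟩
  B ⊛ 1-2β ⊕ negS (κ 1ℚ) ⊕ κ (ι 2) ⊛ (β ⊛ B)
    ≈⟨ (B-1-2β ⟨⊕⟩ ≈-refl _) ⟨⊕⟩ ≈-refl _ ⟩
  κ 1ℚ ⊕ negS (κ 1ℚ) ⊕ κ (ι 2) ⊛ (β ⊛ B)
    ≈⟨ solve 2 (λ u v → con 1ℚ :- con 1ℚ :+ con (ι 2) :* v := con 0ℚ :* u :+ con (ι 2) :* v)
               (≈-refl _) (Lβ 1) (β ⊛ B) ⟩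
  κ 0ℚ ⊛ Lβ 1 ⊕ κ (ι 2) ⊛ (β ⊛ B)
    ≈⟨ ≈-sym (D-⊛≈ (κ (ι 2)) (Lβ 1) (D-κ≈ (ι 2)) D-Lβ1) ⟩
  D (κ (ι 2) ⊛ Lβ 1)
    ∎) refl
  where
  open ≈-Reasoning
  open SeriesSolver

-- Σ C(2k,k)/k² xᵏ = 2 Li₂(β) - Li₁(β)²:  under D both give 2 Li₁(β).
S₂-closed : S₂ ≈ κ (ι 2) ⊛ Lβ 2 ⊕ negS (Lβ 1 ⊛ Lβ 1)
S₂-closed = equal-by-D S₂ (κ (ι 2) ⊛ Lβ 2 ⊕ negS (Lβ 1 ⊛ Lβ 1)) (begin
  D S₂
    ≈⟨ mk≈ D-S₂ ⟩
  S₁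
    ≈⟨ S₁-closed ⟩
  κ (ι 2) ⊛ Lβ 1
    ≈⟨ solve 1 (λ u → con (ι 2) :* u := con (ι 2) :* u :* con 1ℚ) (≈-refl _) (Lβ 1) ⟩
  κ (ι 2) ⊛ Lβ 1 ⊛ κ 1ℚ
    ≈⟨ ≈-refl (κ (ι 2) ⊛ Lβ 1) ⟨⊛⟩ ≈-sym B-1-2β ⟩
  κ (ι 2) ⊛ Lβ 1 ⊛ (B ⊛ 1-2β)
    ≈⟨ solve 4 (λ u v β b → con (ι 2) :* u :* (b :* (con 1ℚ :- con (ι 2) :* β))
                         := con 0ℚ :* v :+ con (ι 2) :* (u :* (con 1ℚ :- con 1ℚ :* β) :* b)
                            :- ((β :* b) :* u :+ u :* (β :* b)))
               (≈-refl _) (Lβ 1) (Lβ 2) β B ⟩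
  κ 0ℚ ⊛ Lβ 2 ⊕ κ (ι 2) ⊛ (Lβ 1 ⊛ 1-β ⊛ B) ⊕ negS (β ⊛ B ⊛ Lβ 1 ⊕ Lβ 1 ⊛ (β ⊛ B))
    ≈⟨ ≈-sym (D-⊕≈ (κ (ι 2) ⊛ Lβ 2) (negS (Lβ 1 ⊛ Lβ 1))
                   (D-⊛≈ (κ (ι 2)) (Lβ 2) (D-κ≈ (ι 2)) (D-Lβ 1))
                   (D-negS≈ (Lβ 1 ⊛ Lβ 1) (D-⊛≈ (Lβ 1) (Lβ 1) D-Lβ1 D-Lβ1))) ⟩
  D (κ (ι 2) ⊛ Lβ 2 ⊕ negS (Lβ 1 ⊛ Lβ 1))
    ∎) refl
  where
  open ≈-Reasoning
  open SeriesSolver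

-- Σ C(2k,k) H_k^{(2)} xᵏ = B (2 Li₂(β) + Li₁(β)²):  both sides solve
-- L f = S₁ = 2 Li₁(β), since L (B Q) = Q · L B + B² (1 - 4x) · D Q.
Q : PowerSeries
Q = κ (ι 2) ⊛ Lβ 2 ⊕ Lβ 1 ⊛ Lβ 1

D-Q : D Q ≈ κ 0ℚ ⊛ Lβ 2 ⊕ κ (ι 2) ⊛ (Lβ 1 ⊛ 1-β ⊛ B) ⊕ (β ⊛ B ⊛ Lβ 1 ⊕ Lβ 1 ⊛ (β ⊛ B))
D-Q = D-⊕≈ (κ (ι 2) ⊛ Lβ 2) (Lβ 1 ⊛ Lβ 1) (D-⊛≈ (κ (ι 2)) (Lβ 2) (D-κ≈ (ι 2)) (D-Lβ 1)) (D-⊛≈ (Lβ 1) (Lβ 1) D-Lβ1 D-Lβ1)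

BH-closed : BH ≈ B ⊛ Q
BH-closed = L-injective BH (B ⊛ Q) (begin
  L BH
    ≈⟨ L-BH ⟩
  S₁
    ≈⟨ S₁-closed ⟩
  κ (ι 2) ⊛ Lβ 1
    ≈⟨ solve 2 (λ q u → con (ι 2) :* u := q :* con 0ℚ :+ con (ι 2) :* u :* con 1ℚ) (≈-refl _) Q (Lβ 1) ⟩
  Q ⊛ κ 0ℚ ⊕ κ (ι 2) ⊛ Lβ 1 ⊛ κ 1ℚ
    ≈⟨ ≈-sym ((≈-refl Q ⟨⊛⟩ L-B) ⟨⊕⟩ (≈-refl (κ (ι 2) ⊛ Lβ 1) ⟨⊛⟩ B²-identity)) ⟩
  Q ⊛ L B ⊕ κ (ι 2) ⊛ Lβ 1 ⊛ (B ⊛ B ⊛ 1-4x)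
    ≈⟨ solve 7 (λ x d b β u v q →
                 q :* ((con 1ℚ :- con (ι 4) :* x) :* d :- con (ι 2) :* x :* b)
                   :+ con (ι 2) :* u :* (b :* b :* (con 1ℚ :- con (ι 4) :* x))
              := (con 1ℚ :- con (ι 4) :* x)
                   :* (d :* q :+ b :* (con 0ℚ :* v :+ con (ι 2) :* (u :* (con 1ℚ :- con 1ℚ :* β) :* b)
                                       :+ (β :* b :* u :+ u :* (β :* b))))
                   :- con (ι 2) :* x :* (b :* q))
               (≈-refl _) X (D B) B β (Lβ 1) (Lβ 2) Q ⟩
  1-4x ⊛ (D B ⊛ Q ⊕ B ⊛ (κ 0ℚ ⊛ Lβ 2 ⊕ κ (ι 2) ⊛ (Lβ 1 ⊛ 1-β ⊛ B) ⊕ (β ⊛ B ⊛ Lβ 1 ⊕ Lβ 1 ⊛ (β ⊛ B))))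
    ⊕ negS (κ (ι 2) ⊛ X ⊛ (B ⊛ Q))
    ≈⟨ ≈-sym ((≈-refl 1-4x ⟨⊛⟩ D-⊛≈ B Q (≈-refl _) D-Q) ⟨⊕⟩ ≈-refl _) ⟩
  L (B ⊛ Q)
    ∎) refl
  where
  open ≈-Reasoning
  open SeriesSolver

R : PowerSeries
R = κ (ι 4) ⊛ Lβ 3 ⊕ κ (pos 2 / 3) ⊛ (Lβ 1 ⊛ (Lβ 1 ⊛ (Lβ 1 ⊛ κ 1ℚ)))

rhsSeries≐R : rhsSeries ≐ R
rhsSeries≐R n = cong₂ _+_ (sym (κ-⊛ (ι 4) (Lβ 3) n)) (begin
  pos 2 / 3 * powS (Lβ 1) 3 n                         ≡⟨ cong (pos 2 / 3 *_) (at cube n) ⟩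
  pos 2 / 3 * (Lβ 1 ⊛ (Lβ 1 ⊛ (Lβ 1 ⊛ κ 1ℚ))) n       ≡⟨ sym (κ-⊛ (pos 2 / 3) (Lβ 1 ⊛ (Lβ 1 ⊛ (Lβ 1 ⊛ κ 1ℚ))) n) ⟩
  (κ (pos 2 / 3) ⊛ (Lβ 1 ⊛ (Lβ 1 ⊛ (Lβ 1 ⊛ κ 1ℚ)))) n ∎)
  where
  open ≡-Reasoning
  cube : powS (Lβ 1) 3 ≈ Lβ 1 ⊛ (Lβ 1 ⊛ (Lβ 1 ⊛ κ 1ℚ))
  cube = ≈-refl (Lβ 1) ⟨⊛⟩ (≈-refl (Lβ 1) ⟨⊛⟩ (≈-refl (Lβ 1) ⟨⊛⟩ mk≈ oneS≐κ1))

D-R : D R ≈ κ (ι 4) ⊛ (Lβ 2 ⊛ 1-β ⊛ B) ⊕ κ (ι 2) ⊛ (Lβ 1 ⊛ Lβ 1 ⊛ (β ⊛ B))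
D-R = begin
  D R
    ≈⟨ D-⊕≈ (κ (ι 4) ⊛ Lβ 3) (κ (pos 2 / 3) ⊛ cube)
            (D-⊛≈ (κ (ι 4)) (Lβ 3) (D-κ≈ (ι 4)) (D-Lβ 2))
            (D-⊛≈ (κ (pos 2 / 3)) cube (D-κ≈ (pos 2 / 3))
              (D-⊛≈ (Lβ 1) (Lβ 1 ⊛ (Lβ 1 ⊛ κ 1ℚ)) D-Lβ1
                (D-⊛≈ (Lβ 1) (Lβ 1 ⊛ κ 1ℚ) D-Lβ1 (D-⊛≈ (Lβ 1) (κ 1ℚ) D-Lβ1 (D-κ≈ 1ℚ))))) ⟩
  κ 0ℚ ⊛ Lβ 3 ⊕ κ (ι 4) ⊛ (Lβ 2 ⊛ 1-β ⊛ B)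
    ⊕ (κ 0ℚ ⊛ cube ⊕ κ (pos 2 / 3) ⊛ (β ⊛ B ⊛ (Lβ 1 ⊛ (Lβ 1 ⊛ κ 1ℚ))
                                       ⊕ Lβ 1 ⊛ (β ⊛ B ⊛ (Lβ 1 ⊛ κ 1ℚ) ⊕ Lβ 1 ⊛ (β ⊛ B ⊛ κ 1ℚ ⊕ Lβ 1 ⊛ κ 0ℚ))))
    ≈⟨ solve 6 (λ w v u β b c →
                 con 0ℚ :* w :+ con (ι 4) :* (v :* (con 1ℚ :- con 1ℚ :* β) :* b)
                   :+ (con 0ℚ :* c :+ con (pos 2 / 3) :* (β :* b :* (u :* (u :* con 1ℚ))
                        :+ u :* (β :* b :* (u :* con 1ℚ) :+ u :* (β :* b :* con 1ℚ :+ u :* con 0ℚ))))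
              := con (ι 4) :* (v :* (con 1ℚ :- con 1ℚ :* β) :* b) :+ con (ι 2) :* (u :* u :* (β :* b)))
               (≈-refl _) (Lβ 3) (Lβ 2) (Lβ 1) β B cube ⟩
  κ (ι 4) ⊛ (Lβ 2 ⊛ 1-β ⊛ B) ⊕ κ (ι 2) ⊛ (Lβ 1 ⊛ Lβ 1 ⊛ (β ⊛ B))
    ∎
  where
  open ≈-Reasoning
  open SeriesSolver
  cube : PowerSeries
  cube = Lβ 1 ⊛ (Lβ 1 ⊛ (Lβ 1 ⊛ κ 1ℚ))

-- With the closed forms of BH and S₂, D of the left-hand side differs from
-- D R by a multiple of B (1 - 2β) - 1 = 0.
D-lhs≈D-R : D lhsSeries ≈ D R
D-lhs≈D-R = begin
  D lhsSeries
    ≈⟨ mk≈ D-lhs ⟩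
  BH ⊕ S₂
    ≈⟨ BH-closed ⟨⊕⟩ S₂-closed ⟩
  B ⊛ Q ⊕ (κ (ι 2) ⊛ Lβ 2 ⊕ negS (Lβ 1 ⊛ Lβ 1))
    ≈⟨ solve 4 (λ u v β b →
                 b :* (con (ι 2) :* v :+ u :* u) :+ (con (ι 2) :* v :- u :* u)
              := con (ι 4) :* (v :* (con 1ℚ :- con 1ℚ :* β) :* b) :+ con (ι 2) :* (u :* u :* (β :* b))
                 :+ (u :* u :- con (ι 2) :* v) :* (b :* (con 1ℚ :- con (ι 2) :* β) :- con 1ℚ))
               (≈-refl _) (Lβ 1) (Lβ 2) β B ⟩
  DR-form ⊕ (Lβ 1 ⊛ Lβ 1 ⊕ negS (κ (ι 2) ⊛ Lβ 2)) ⊛ (B ⊛ 1-2β ⊕ negS (κ 1ℚ))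
    ≈⟨ ≈-refl DR-form ⟨⊕⟩ (≈-refl (Lβ 1 ⊛ Lβ 1 ⊕ negS (κ (ι 2) ⊛ Lβ 2)) ⟨⊛⟩ (B-1-2β ⟨⊕⟩ ≈-refl (negS (κ 1ℚ)))) ⟩
  DR-form ⊕ (Lβ 1 ⊛ Lβ 1 ⊕ negS (κ (ι 2) ⊛ Lβ 2)) ⊛ (κ 1ℚ ⊕ negS (κ 1ℚ))
    ≈⟨ solve 2 (λ c d → c :+ d :* (con 1ℚ :- con 1ℚ) := c) (≈-refl _) DR-form (Lβ 1 ⊛ Lβ 1 ⊕ negS (κ (ι 2) ⊛ Lβ 2)) ⟩
  DR-form
    ≈⟨ ≈-sym D-R ⟩
  D R
    ∎
  where
  open ≈-Reasoning
  open SeriesSolver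
  DR-form : PowerSeries
  DR-form = κ (ι 4) ⊛ (Lβ 2 ⊛ 1-β ⊛ B) ⊕ κ (ι 2) ⊛ (Lβ 1 ⊛ Lβ 1 ⊛ (β ⊛ B))

theorem5p2 : (n : ℕ) → lhsSeries n ≡ rhsSeries n
theorem5p2 n = begin
  lhsSeries n  ≡⟨ at lhs≈R n ⟩
  R n          ≡⟨ sym (rhsSeries≐R n) ⟩
  rhsSeries n  ∎
  where
  open ≡-Reasoning
  lhs≈R : lhsSeries ≈ R
  lhs≈R = equal-by-D lhsSeries R D-lhs≈D-R refl
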